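{- Let $(X,\mathcal{C})$ be a closure space, let $\mathcal{M}$ be a closure model over it, and let $\mathbf{F}_1,\mathbf{F}_2$ be arbitrary formulas. Then for every point $x\in X$: $$\mathcal{M},x\models \mathbf{F}_1\,\mathcal{S}\,\mathbf{F}_2 \iff \mathcal{M},x\models \mathbf{F}_1\wedge\neg\,\rho\big[\neg(\mathbf{F}_1\vee\mathbf{F}_2)\big][\neg\mathbf{F}_2].$$ That is, $\mathbf{F}_1\,\mathcal{S}\,\mathbf{F}_2$ and $\mathbf{F}_1\wedge\neg\,\rho[\neg(\mathbf{F}_1\vee\mathbf{F}_2)][\neg\mathbf{F}_2]$ are satisfied by exactly the same points.
   Context: A closure space is a pair $(X,\mathcal{C})$ with $X$ a non-empty set and $\mathcal{C}:2^X\to 2^X$ satisfying $\mathcal{C}(\emptyset)=\emptyset$, $Y\subseteq\mathcal{C}(Y)$ for all $Y\subseteq X$, and $\mathcal{C}(Y_1\cup Y_2)=\mathcal{C}(Y_1)\cup\mathcal{C}(Y_2)$. Let $(\mathbb{N},\mathcal{C}_{Succ})$ be the closure space on the natural numbers with $\mathcal{C}_{Succ}(Y)=Y\cup\{n+1: n\in Y\}$. A path in $(X,\mathcal{C})$ is a function $\pi:\mathbb{N}\to X$ such that $\pi(\mathcal{C}_{Succ}(Y))\subseteq\mathcal{C}(\pi(Y))$ for all $Y\subseteq\mathbb{N}$. A closure model $\mathcal{M}$ over $(X,\mathcal{C})$ assigns to each formula $\mathbf{F}$ a satisfaction relation $\mathcal{M},x\models\mathbf{F}$ for $x\in X$; formulas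 are built from atomic predicates (interpreted by a valuation assigning a subset of $X$ to each predicate) using $\neg$, $\wedge$ (with $\vee$ defined as usual), and the operators below, with the standard semantics for $\neg,\wedge,\vee$. The "may reach" operator: $\mathcal{M},x\models\rho[\mathbf{F}_1][\mathbf{F}_2]$ iff there exist a path $\pi$ and an index $\ell\in\mathbb{N}$ with $\pi(0)=x$, $\mathcal{M},\pi(\ell)\models\mathbf{F}_1$, and $\mathcal{M},\pi(j)\models\mathbf{F}_2$ for all $j$ with $0<j<\ell$. The "surrounded" operator: $\mathcal{M},x\models\mathbf{F}_1\,\mathcal{S}\,\mathbf{F}_2$ iff $\mathcal{M},x\models\mathbf{F}_1$ and for all paths $\pi$ and indexes $\ell$, if $\pi(0)=x$ and $\mathcal{M},\pi(\ell)\models\neg\mathbf{F}_1$ then there exists an index $j$ with $0<j\le\ell$ and $\mathcal{M},\pi(j)\models\mathbf{F}_2$. -}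

module Defs where

open import Level using (0ℓ; suc; Lift)
open import Data.Nat using (ℕ; zero; _<_; _≤_) renaming (suc to 1+)
open import Data.Product using (Σ; ∃; _×_; _,_)
open import Data.Sum using (_⊎_)
open import Relation.Nullary using (¬_)
open import Relation.Binary.PropositionalEquality using (_≡_)
open import Relation.Unary using (Pred; ∅; _⊆_; _≐_; _∪_)

record ClosureSpace : Set₁ where
  field
    X        : Set
    nonEmpty : X
    C        : Pred X 0ℓ → Pred X 0ℓ
    C-∅      : C ∅ ≐ ∅
    C-incl   : ∀ (Y : Pred X 0ℓ) → Y ⊆ C Y
    C-∪      : ∀ (Y₁ Y₂ : Pred X 0ℓ) → C (Y₁ ∪ Y₂) ≐ (C Y₁ ∪ C Y₂)

CSucc : Pred ℕ 0ℓ → Pred ℕ 0ℓ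
CSucc Y m = Y m ⊎ ∃ λ n → Y n × m ≡ 1+ n

image : {A B : Set} → (A → B) → Pred A 0ℓ → Pred B 0ℓ
image f Y b = ∃ λ a → Y a × f a ≡ b

-- Paths: continuous functions from (ℕ, C_Succ) into (X, C).
IsPath : (S : ClosureSpace) → (ℕ → ClosureSpace.X S) → Set₁
IsPath S π = ∀ (Y : Pred ℕ 0ℓ) → image π (CSucc Y) ⊆ C (image π Y)
  where open ClosureSpace S

data Formula (AP : Set) : Set where
  atom : AP → Formula AP
  ¬ᶠ_  : Formula AP → Formula AP
  _∧ᶠ_ : Formula AP → Formula AP → Formula AP
  ρ[_][_] : Formula AP → Formula AP → Formula AP
  _𝒮_  : Formula AP → Formula AP → Formula AP

_∨ᶠ_ : {AP : Set} → Formula AP → Formula AP → Formula AP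
F₁ ∨ᶠ F₂ = ¬ᶠ ((¬ᶠ F₁) ∧ᶠ (¬ᶠ F₂))

record ClosureModel (AP : Set) : Set₁ where
  field
    space : ClosureSpace
  open ClosureSpace space public
  field
    V : AP → Pred X 0ℓ

_,_⊨_ : {AP : Set} (M : ClosureModel AP) → ClosureModel.X M → Formula AP → Set₁
M , x ⊨ atom p = Lift (suc 0ℓ) (ClosureModel.V M p x)
M , x ⊨ (¬ᶠ F) = ¬ (M , x ⊨ F)
M , x ⊨ (F₁ ∧ᶠ F₂) = (M , x ⊨ F₁) × (M , x ⊨ F₂)
M , x ⊨ ρ[ F₁ ][ F₂ ] =
  Σ (ℕ → ClosureModel.X M) λ π → Σ ℕ λ ℓ →
    IsPath (ClosureModel.space M) π × π 0 ≡ x × (M , π ℓ ⊨ F₁) ×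
    (∀ j → 0 < j → j < ℓ → M , π j ⊨ F₂)
M , x ⊨ (F₁ 𝒮 F₂) =
  (M , x ⊨ F₁) ×
  (∀ (π : ℕ → ClosureModel.X M) (ℓ : ℕ) → IsPath (ClosureModel.space M) π →
     π 0 ≡ x → ¬ (M , π ℓ ⊨ F₁) →
     Σ ℕ λ j → 0 < j × j ≤ ℓ × (M , π j ⊨ F₂))

module Submission where

-- Both sides quantify over the same paths π from x; what differs is only the
-- condition imposed on the finite segment π 1, …, π ℓ.  The surrounded
-- operator asks that F₂ is hit somewhere in (0, ℓ] whenever F₁ fails at ℓ;
-- the may-reach formula forbids a segment that avoids F₂ on (0, ℓ) and ends
-- in a point satisfying neither F₁ nor F₂.  So the proof is a statement
-- about predicates on an index range, independent of paths and closures: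
--   * `hit-at-end`: a hit in (0, ℓ] that avoids (0, ℓ) lies at ℓ itself;
--   * `¬hit⇒avoids`, `¬hit⇒¬end`: failing to hit in (0, ℓ] means avoiding
--     (0, ℓ) and, for ℓ > 0, missing ℓ.
-- The left-to-right direction is constructive; the converse turns
-- "no bad segment" into an explicit hit, which needs excluded middle
-- (as double-negation elimination).

open import Defs
open import Level using (Level; 0ℓ; suc)
open import Function.Bundles using (_⇔_; mk⇔)
open import Axiom.ExcludedMiddle using (ExcludedMiddle)
open import Axiom.DoubleNegationElimination using (em⇒dne)
open import Data.Nat using (ℕ; zero; _<_; _≤_; z<s) renaming (suc to 1+)
open import Data.Nat.Properties using (≤-refl; <⇒≤; m≤n⇒m<n∨m≡n)
open import Data.Product using (Σ; _×_; _,_)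
open import Data.Sum using (inj₁; inj₂)
open import Data.Empty using (⊥-elim)
open import Relation.Nullary using (¬_)
open import Relation.Binary.PropositionalEquality using (refl; sym; subst)

private
  variable
    a : Level

HitWithin : (ℕ → Set a) → ℕ → Set a
HitWithin P ℓ = Σ ℕ λ j → 0 < j × j ≤ ℓ × P j

AvoidsBefore : (ℕ → Set a) → ℕ → Set a
AvoidsBefore P ℓ = ∀ j → 0 < j → j < ℓ → ¬ P j

hit-at-end : {P : ℕ → Set a} {ℓ : ℕ} → HitWithin P ℓ → AvoidsBefore P ℓ → P ℓ
hit-at-end (j , 0<j , j≤ℓ , Pj) avoid with m≤n⇒m<n∨m≡n j≤ℓ
... | inj₁ j<ℓ = ⊥-elim (avoid j 0<j j<ℓ Pj)
... | inj₂ refl = Pj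

¬hit⇒avoids : {P : ℕ → Set a} {ℓ : ℕ} → ¬ HitWithin P ℓ → AvoidsBefore P ℓ
¬hit⇒avoids ¬hit j 0<j j<ℓ Pj = ¬hit (j , 0<j , <⇒≤ j<ℓ , Pj)

¬hit⇒¬end : {P : ℕ → Set a} {ℓ : ℕ} → 0 < ℓ → ¬ HitWithin P ℓ → ¬ P ℓ
¬hit⇒¬end 0<ℓ ¬hit Pℓ = ¬hit (_ , 0<ℓ , ≤-refl , Pℓ)

leaves-start : (P : ℕ → Set a) (ℓ : ℕ) → P 0 → ¬ P ℓ → 0 < ℓ
leaves-start P zero   P0 ¬Pℓ = ⊥-elim (¬Pℓ P0)
leaves-start P (1+ ℓ) P0 ¬Pℓ = z<s

-- Negated disjunction, for the encoding A ∨ B = ¬(¬A ∧ ¬B) used by `_∨ᶠ_`.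
¬∨-intro : {A B : Set a} → ¬ A → ¬ B → ¬ ¬ (¬ A × ¬ B)
¬∨-intro ¬A ¬B ¬both = ¬both (¬A , ¬B)

¬∨-elimˡ : {A B : Set a} → ¬ ¬ (¬ A × ¬ B) → ¬ A
¬∨-elimˡ ¬¬both A = ¬¬both λ (¬A , _) → ¬A A

¬∨-elimʳ : {A B : Set a} → ¬ ¬ (¬ A × ¬ B) → ¬ B
¬∨-elimʳ ¬¬both B = ¬¬both λ (_ , ¬B) → ¬B B

proposition1 : ExcludedMiddle (suc 0ℓ) →
    {AP : Set} (M : ClosureModel AP) (F₁ F₂ : Formula AP) (x : ClosureModel.X M) →
    (M , x ⊨ (F₁ 𝒮 F₂)) ⇔ (M , x ⊨ (F₁ ∧ᶠ (¬ᶠ ρ[ ¬ᶠ (F₁ ∨ᶠ F₂) ][ ¬ᶠ F₂ ])))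
proposition1 em M F₁ F₂ x = mk⇔ surrounded⇒¬badReach ¬badReach⇒surrounded
  where
  F₁-along F₂-along : (ℕ → ClosureModel.X M) → ℕ → Set₁
  F₁-along π j = M , π j ⊨ F₁
  F₂-along π j = M , π j ⊨ F₂

  -- A may-reach witness ends outside F₁ ∨ F₂ after avoiding F₂, so
  -- surroundedness would force F₂ at its end.
  surrounded⇒¬badReach : M , x ⊨ (F₁ 𝒮 F₂) →
    M , x ⊨ (F₁ ∧ᶠ (¬ᶠ ρ[ ¬ᶠ (F₁ ∨ᶠ F₂) ][ ¬ᶠ F₂ ]))
  surrounded⇒¬badReach (F₁x , surround) =
    F₁x , λ (π , ℓ , path , π0≡x , neither , avoid) →
      ¬∨-elimʳ neither
        (hit-at-end {P = F₂-along π}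
          (surround π ℓ path π0≡x (¬∨-elimˡ neither)) avoid)

  -- A path leaving F₁ with no F₂ in (0, ℓ] would be a may-reach witness.
  ¬badReach⇒surrounded : M , x ⊨ (F₁ ∧ᶠ (¬ᶠ ρ[ ¬ᶠ (F₁ ∨ᶠ F₂) ][ ¬ᶠ F₂ ])) →
    M , x ⊨ (F₁ 𝒮 F₂)
  ¬badReach⇒surrounded (F₁x , ¬reach) = F₁x , λ π ℓ path π0≡x ¬F₁ℓ →
    let F₁-start = subst (λ y → M , y ⊨ F₁) (sym π0≡x) F₁x
        0<ℓ = leaves-start (F₁-along π) ℓ F₁-start ¬F₁ℓ
    in em⇒dne em λ ¬hit →
         ¬reach (π , ℓ , path , π0≡x ,
                 ¬∨-intro ¬F₁ℓ (¬hit⇒¬end 0<ℓ ¬hit) ,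
                 ¬hit⇒avoids ¬hit)
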